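{- Let $V$ be a vocabulary and let $\varphi[\vec f^{\,V},\vec g^{\,V}]$ be any formula with two distinguished vectors of function variables $\vec f,\vec g$ for $V$ (any other free variables being held fixed as parameters). Then there is a formula $\varphi^*[\vec f^{\,V},\vec g^{\,V}]$ that defines the relation $[\varphi]^*$: for every $A$-structure $\sigma$, $\sigma\models\varphi^*[\vec f,\vec g]$ iff $[\varphi]^*(\sigma(\vec f),\sigma(\vec g))$ holds.
   Context: Fix a denumerable set $A$ of atoms and a fresh "undefined" object $\bot$. A $k$-ary $A$-function is a finite partial function $A^k\rightharpoonup A$, identified with its strict extension to $A\cup\{\bot\}$; nullary ones are elements of $A\cup\{\bot\}$. Variables come with arities $k\ge0$. Terms: $\omega$ (denoting $\bot$) and $f t_1\cdots t_k$ for a $k$-ary variable $f$. Formulas: equations $t\doteq q$, closed under $\neg,\wedge,\vee,\to$ and quantifiers $\forall f,\exists f$ over variables of any arity. An $A$-structure $\sigma$ assigns a $k$-ary $A$-function to each $k$-ary variable; $\sigma\models t\doteq q$ iff the values agree, connectives as usual, and $\forall f^k$/$\exists f^k$ range over all finite $F:A^k\rightharpoonup A$ (atomic quantifiers over all of $A\cup\{\bot\}$). For a vocabulary $V=f_1^{r_1}\dots f_k^{r_k}$, $\vec f^{\,V}$ denotes a vector of variables $f_1\dots f_k$ of arities $r_1,\dots,r_k$. The relation $[\varphi]^*$ on pairs of vectors of $A$-functions (of the arities of $V$) is the reflexive–transitive closure of the relation defined by $\varphi$: it is the least relation such that $[\varphi]^*(\vec F,\vec F)$ for all $\vec F$, and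 if $\varphi[\vec F,\vec G]$ and $[\varphi]^*(\vec G,\vec H)$ then $[\varphi]^*(\vec F,\vec H)$; equivalently, $[\varphi]^*(\vec F,\vec G)$ iff there are $\vec H_0,\dots,\vec H_k$ ($k\ge0$) with $\vec H_0=\vec F$, $\vec H_k=\vec G$ and $\varphi[\vec H_i,\vec H_{i+1}]$ for $i<k$. -}

module Defs where

open import Data.Nat using (ℕ; zero; suc; _≟_)
open import Data.Maybe using (Maybe; just; nothing)
open import Data.Vec using (Vec; []; _∷_; lookup)
open import Data.Fin using (Fin; zero; suc)
open import Data.List using (List)
open import Data.List.Membership.Propositional using (_∈_)
open import Data.Product using (Σ; ∃; _×_; _,_)
open import Data.Sum using (_⊎_; inj₁; inj₂)
open import Data.Empty using (⊥)
open import Relation.Nullary using (¬_; yes; no)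
open import Relation.Binary.PropositionalEquality using (_≡_; refl)

-- Atoms: A = ℕ (a denumerable set).  A ∪ {⊥} is represented as Maybe ℕ,
-- with nothing playing the role of the undefined object ⊥.
Atom : Set
Atom = ℕ

Val : Set
Val = Maybe Atom

-- A k-ary A-function: a finite partial function A^k ⇀ A, given by its graph
-- as a map Vec Atom k → Maybe Atom whose domain is contained in a finite list.
record AFun (k : ℕ) : Set where
  constructor afun
  field
    fun    : Vec Atom k → Val
    finite : Σ (List (Vec Atom k)) λ L → ∀ x → ¬ (fun x ≡ nothing) → x ∈ L
open AFun public

-- Variables: an arity k together with a name (a natural number).
-- Terms: ω, and f t₁ ⋯ t_k for a k-ary variable f.
data Term : Set where
  ω   : Term
  app : (k : ℕ) (x : ℕ) → Vec Term k → Term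

data Formula : Set where
  _≐_  : Term → Term → Formula
  ¬'_  : Formula → Formula
  _∧'_ : Formula → Formula → Formula
  _∨'_ : Formula → Formula → Formula
  _⇒'_ : Formula → Formula → Formula
  ∀'   : (k : ℕ) (x : ℕ) → Formula → Formula
  ∃'   : (k : ℕ) (x : ℕ) → Formula → Formula

Structure : Set
Structure = (k : ℕ) → ℕ → AFun k

strictApp : ∀ {k} → (Vec Atom k → Val) → Vec Val k → Val
strictApp {k} F vs = go vs (λ as → F as)
  where
    go : ∀ {m} → Vec Val m → (Vec Atom m → Val) → Val
    go []             c = c []
    go (nothing ∷ vs) c = nothing
    go (just a ∷ vs)  c = go vs (λ as → c (a ∷ as))

mutual
  eval : Structure → Term → Val
  eval σ ω           = nothing
  eval σ (app k x ts) = strictApp (fun (σ k x)) (evalVec σ ts)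

  evalVec : ∀ {m} → Structure → Vec Term m → Vec Val m
  evalVec σ []       = []
  evalVec σ (t ∷ ts) = eval σ t ∷ evalVec σ ts

update : Structure → (k : ℕ) → ℕ → AFun k → Structure
update σ k x F k' x' with k ≟ k' | x ≟ x'
... | yes refl | yes refl = F
... | yes refl | no _     = σ k' x'
... | no _     | _        = σ k' x'

_⊨_ : Structure → Formula → Set
σ ⊨ (t ≐ q)    = eval σ t ≡ eval σ q
σ ⊨ (¬' φ)     = ¬ (σ ⊨ φ)
σ ⊨ (φ ∧' ψ)   = (σ ⊨ φ) × (σ ⊨ ψ)
σ ⊨ (φ ∨' ψ)   = (σ ⊨ φ) ⊎ (σ ⊨ ψ)
σ ⊨ (φ ⇒' ψ)   = (σ ⊨ φ) → (σ ⊨ ψ)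
σ ⊨ (∀' k x φ) = (F : AFun k) → update σ k x F ⊨ φ
σ ⊨ (∃' k x φ) = Σ (AFun k) λ F → update σ k x F ⊨ φ

-- A vocabulary V = f₁^{r₁} … f_n^{r_n} is its vector of arities.
Vocabulary : ℕ → Set
Vocabulary n = Vec ℕ n

-- A vector of variables for V: names of variables of arities lookup V i.
VarVec : ∀ {n} → Vocabulary n → Set
VarVec {n} V = Fin n → ℕ

FunVec : ∀ {n} → Vocabulary n → Set
FunVec {n} V = (i : Fin n) → AFun (lookup V i)

valVec : ∀ {n} (V : Vocabulary n) → Structure → VarVec V → FunVec V
valVec V σ fs i = σ (lookup V i) (fs i)

-- Simultaneous update σ[f⃗ := F⃗] (sequential; order irrelevant for distinct variables).
updateVec : ∀ {n} (V : Vocabulary n) → Structure → VarVec V → FunVec V → Structure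
updateVec {zero}  V       σ fs Fs = σ
updateVec {suc n} (r ∷ V) σ fs Fs =
  updateVec V (update σ r (fs zero) (Fs zero)) (λ i → fs (suc i)) (λ i → Fs (suc i))

FunEq : ∀ {n} (V : Vocabulary n) → FunVec V → FunVec V → Set
FunEq V F G = ∀ i x → fun (F i) x ≡ fun (G i) x

Distinct : ∀ {n} (V : Vocabulary n) → VarVec V → VarVec V → Set
Distinct {n} V fs gs = ∀ (a b : Fin n ⊎ Fin n) → var a ≡ var b → a ≡ b
  where
    var : Fin n ⊎ Fin n → ℕ × ℕ
    var (inj₁ i) = lookup V i , fs i
    var (inj₂ i) = lookup V i , gs i

Rel : ∀ {n} (V : Vocabulary n) → Structure → VarVec V → VarVec V → Formula
    → FunVec V → FunVec V → Set
Rel V σ fs gs φ F G = updateVec V (updateVec V σ fs F) gs G ⊨ φ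

-- Reflexive–transitive closure [φ]* (least relation containing identity,
-- closed under prefixing a φ-step); identity of A-functions is extensional.
data Star {n} (V : Vocabulary n) (R : FunVec V → FunVec V → Set)
     : FunVec V → FunVec V → Set where
  base : ∀ {F G} → FunEq V F G → Star V R F G
  step : ∀ {F G H} → R F G → Star V R G H → Star V R F H

-- A φ-path F⃗₀, …, F⃗ₘ from f⃗ to g⃗ is coded by finitely many functions: a unary s with
-- s(t) = t + 1 below m, atoms a = 0 and b = m, and a table h⃗ with hᵢ(t, x⃗) = F_{t,i}(x⃗).
-- So φ* says: there are s, a, b, h⃗ such that f⃗ and g⃗ are the a- and b-slices of h⃗, b lies in
-- every finite set (a unary function) that contains a and is closed under s, and φ holds
-- between the t-slice and the s(t)-slice whenever s(t) is defined.  Conversely, as s has a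
-- finite domain, the s-orbit of a is finite and closed under s (pigeonhole), so the closure
-- condition yields b = sᵐ(a) and the slices along the orbit form a φ-path.  All auxiliary
-- variables are chosen above every name in φ, f⃗, g⃗, so the parameters of φ are untouched.

module Submission where

open import Defs
open import Data.Nat using (ℕ; zero; suc; _≟_; _+_; _∸_; _<_; _≤_; _⊔_; _<?_; _≤?_; z≤n; s≤s)
open import Data.Nat.Properties
  using (≤-refl; ≤-trans; <⇒≤; ≤-pred; n≤1+n; m≤n⇒m<n∨m≡n; m∸n+n≡m; +-monoʳ-<; +-monoʳ-≤;
         m⊔n≤o⇒m≤o; m⊔n≤o⇒n≤o; m≤m⊔n; m≤n⊔m; m≤m+n; +-cancelˡ-≡; <⇒≱)
open import Data.Maybe using (Maybe; just; nothing; _>>=_)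
open import Data.Vec using (Vec; []; _∷_; lookup; tabulate; head; tail)
open import Data.Vec.Properties using (tabulate-cong)
open import Data.Fin using (Fin; zero; suc; toℕ)
open import Data.Fin.Properties using (pigeonhole; toℕ<n; toℕ-injective)
open import Data.List using (List; []; _∷_; _++_; map; length; upTo; concatMap; fromMaybe)
open import Data.List.Membership.Propositional using (_∈_; lose)
open import Data.List.Membership.Propositional.Properties
  using (∈-map⁺; ∈-++⁺ʳ; ∈-++⁻; ∈-upTo⁺; ∈-concatMap⁺)
open import Data.List.Membership.DecPropositional _≟_ using (_∈?_)
open import Data.List.Relation.Unary.Any using (here; index)
open import Data.List.Relation.Unary.Any.Properties using (lookup-index)
open import Data.Product using (Σ; ∃; ∃₂; _×_; _,_; proj₁; proj₂; uncurry)
open import Data.Sum using (inj₁; inj₂)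
open import Data.Empty using (⊥; ⊥-elim)
open import Data.Unit using (⊤; tt)
open import Relation.Nullary using (¬_; yes; no)
open import Relation.Binary.PropositionalEquality
  using (_≡_; _≢_; _≗_; refl; sym; trans; cong; cong₂; subst; module ≡-Reasoning)
open import Function.Bundles using (_⇔_; mk⇔; Equivalence)
import Function.Properties.Equivalence as ⇔

record Agree (P : ℕ → Set) (σ τ : Structure) : Set where
  constructor agreeing
  field agree : ∀ k x → P x → fun (σ k x) ≗ fun (τ k x)
open Agree

module _ {P : ℕ → Set} where

  agree-sym : ∀ {σ τ} → Agree P σ τ → Agree P τ σ
  agree-sym (agreeing a) = agreeing λ k x p v → sym (a k x p v)

  agree-trans : ∀ {σ τ ρ} → Agree P σ τ → Agree P τ ρ → Agree P σ ρ
  agree-trans (agreeing a) (agreeing b) = agreeing λ k x p v → trans (a k x p v) (b k x p v)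

  update-agree : ∀ {σ τ k x} {F G : AFun k} → Agree P σ τ → fun F ≗ fun G →
                 Agree P (update σ k x F) (update τ k x G)
  update-agree {σ} {τ} {k} {x} {F} {G} (agreeing a) F≗G = agreeing pointwise
    where
      pointwise : ∀ k′ x′ → P x′ → fun (update σ k x F k′ x′) ≗ fun (update τ k x G k′ x′)
      pointwise k′ x′ p with k ≟ k′ | x ≟ x′
      ... | yes refl | yes refl = F≗G
      ... | yes refl | no _     = a k′ x′ p
      ... | no _     | _        = a k′ x′ p

  update-fresh : ∀ σ k x (F : AFun k) → ¬ P x → Agree P σ (update σ k x F)
  update-fresh σ k x F ¬Px = agreeing pointwise
    where
      pointwise : ∀ k′ x′ → P x′ → fun (σ k′ x′) ≗ fun (update σ k x F k′ x′)
      pointwise k′ x′ p with k ≟ k′ | x ≟ x′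
      ... | yes refl | yes refl = ⊥-elim (¬Px p)
      ... | yes refl | no _     = λ _ → refl
      ... | no _     | _        = λ _ → refl

update-other : ∀ σ {k} x (F : AFun k) k′ x′ → (k ≡ k′ → x ≡ x′ → ⊥) →
               update σ k x F k′ x′ ≡ σ k′ x′
update-other σ {k} x F k′ x′ ≢ with k ≟ k′ | x ≟ x′
... | yes refl | yes refl = ⊥-elim (≢ refl refl)
... | yes refl | no _     = refl
... | no _     | _        = refl

update-same : ∀ σ {k} x (F : AFun k) → update σ k x F k x ≡ F
update-same σ {k} x F with k ≟ k | x ≟ x
... | yes refl | yes refl = refl
... | yes refl | no x≢x   = ⊥-elim (x≢x refl)
... | no k≢k   | _        = ⊥-elim (k≢k refl)

updates : ∀ {n} (ar : Fin n → ℕ) → Structure → (Fin n → ℕ) → ((i : Fin n) → AFun (ar i)) → Structure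
updates {zero}  ar σ xs Fs = σ
updates {suc n} ar σ xs Fs =
  updates (λ i → ar (suc i)) (update σ (ar zero) (xs zero) (Fs zero)) (λ i → xs (suc i)) (λ i → Fs (suc i))

updateVec≡updates : ∀ {n} (V : Vocabulary n) σ xs Fs → updateVec V σ xs Fs ≡ updates (lookup V) σ xs Fs
updateVec≡updates {zero}  V       σ xs Fs = refl
updateVec≡updates {suc n} (r ∷ V) σ xs Fs = updateVec≡updates V _ _ _

DistinctNames : ∀ {n} → (Fin n → ℕ) → (Fin n → ℕ) → Set
DistinctNames ar xs = ∀ i j → ar i ≡ ar j → xs i ≡ xs j → i ≡ j

module _ {P : ℕ → Set} where

  updates-agree : ∀ {n σ τ} (ar : Fin n → ℕ) xs {Fs Gs} → Agree P σ τ → (∀ i → fun (Fs i) ≗ fun (Gs i)) →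
                  Agree P (updates ar σ xs Fs) (updates ar τ xs Gs)
  updates-agree {zero}  ar xs σ≈τ Fs≗Gs = σ≈τ
  updates-agree {suc n} ar xs σ≈τ Fs≗Gs =
    updates-agree (λ i → ar (suc i)) (λ i → xs (suc i)) (update-agree σ≈τ (Fs≗Gs zero)) (λ i → Fs≗Gs (suc i))

  updates-fresh : ∀ {n} (ar : Fin n → ℕ) σ xs Fs → (∀ j → ¬ P (xs j)) → Agree P σ (updates ar σ xs Fs)
  updates-fresh {zero}  ar σ xs Fs fresh = agreeing λ _ _ _ _ → refl
  updates-fresh {suc n} ar σ xs Fs fresh =
    agree-trans (update-fresh σ (ar zero) (xs zero) (Fs zero) (fresh zero))
                (updates-fresh (λ i → ar (suc i)) _ (λ i → xs (suc i)) (λ i → Fs (suc i)) (λ j → fresh (suc j)))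

updates-other : ∀ {n} (ar : Fin n → ℕ) σ xs Fs {k x} → (∀ j → ar j ≡ k → xs j ≡ x → ⊥) →
                updates ar σ xs Fs k x ≡ σ k x
updates-other {zero}  ar σ xs Fs ≢ = refl
updates-other {suc n} ar σ xs Fs {k} {x} ≢ =
  trans (updates-other (λ i → ar (suc i)) _ (λ i → xs (suc i)) (λ i → Fs (suc i)) (λ j → ≢ (suc j)))
        (update-other σ (xs zero) (Fs zero) k x (≢ zero))

updates-same : ∀ {n} (ar : Fin n → ℕ) σ xs Fs → DistinctNames ar xs →
               ∀ i → updates ar σ xs Fs (ar i) (xs i) ≡ Fs i
updates-same {suc n} ar σ xs Fs distinct zero =
  trans (updates-other (λ i → ar (suc i)) _ (λ i → xs (suc i)) (λ i → Fs (suc i)) later≢first)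
        (update-same σ (xs zero) (Fs zero))
  where
    later≢first : ∀ j → ar (suc j) ≡ ar zero → xs (suc j) ≡ xs zero → ⊥
    later≢first j p q with distinct (suc j) zero p q
    ... | ()
updates-same {suc n} ar σ xs Fs distinct (suc i) =
  updates-same (λ i → ar (suc i)) _ (λ i → xs (suc i)) (λ i → Fs (suc i)) distinct′ i
  where
    distinct′ : DistinctNames (λ i → ar (suc i)) (λ i → xs (suc i))
    distinct′ i j p q with distinct (suc i) (suc j) p q
    ... | refl = refl

-- Satisfaction depends only on the names below a bound

strictApp-cong : ∀ {k} {F G : Vec Atom k → Val} → F ≗ G → ∀ vs → strictApp F vs ≡ strictApp G vs
strictApp-cong F≗G []             = F≗G []
strictApp-cong F≗G (nothing ∷ vs) = refl
strictApp-cong F≗G (just a ∷ vs)  = strictApp-cong (λ as → F≗G (a ∷ as)) vs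

strictApp-atoms : ∀ {k} (F : Vec Atom k → Val) (as : Vec Atom k) →
                  strictApp F (tabulate (λ j → just (lookup as j))) ≡ F as
strictApp-atoms F []       = refl
strictApp-atoms F (a ∷ as) = strictApp-atoms (λ as′ → F (a ∷ as′)) as

mutual
  TermBelow : ℕ → Term → Set
  TermBelow B ω            = ⊤
  TermBelow B (app k x ts) = x < B × TermsBelow B ts

  TermsBelow : ∀ {m} → ℕ → Vec Term m → Set
  TermsBelow B []       = ⊤
  TermsBelow B (t ∷ ts) = TermBelow B t × TermsBelow B ts

FormulaBelow : ℕ → Formula → Set
FormulaBelow B (t ≐ q)    = TermBelow B t × TermBelow B q
FormulaBelow B (¬' φ)     = FormulaBelow B φ
FormulaBelow B (φ ∧' ψ)   = FormulaBelow B φ × FormulaBelow B ψ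
FormulaBelow B (φ ∨' ψ)   = FormulaBelow B φ × FormulaBelow B ψ
FormulaBelow B (φ ⇒' ψ)   = FormulaBelow B φ × FormulaBelow B ψ
FormulaBelow B (∀' k x φ) = FormulaBelow B φ
FormulaBelow B (∃' k x φ) = FormulaBelow B φ

mutual
  termBound : Term → ℕ
  termBound ω            = 0
  termBound (app k x ts) = suc x ⊔ termsBound ts

  termsBound : ∀ {m} → Vec Term m → ℕ
  termsBound []       = 0
  termsBound (t ∷ ts) = termBound t ⊔ termsBound ts

formulaBound : Formula → ℕ
formulaBound (t ≐ q)    = termBound t ⊔ termBound q
formulaBound (¬' φ)     = formulaBound φ
formulaBound (φ ∧' ψ)   = formulaBound φ ⊔ formulaBound ψ
formulaBound (φ ∨' ψ)   = formulaBound φ ⊔ formulaBound ψ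
formulaBound (φ ⇒' ψ)   = formulaBound φ ⊔ formulaBound ψ
formulaBound (∀' k x φ) = formulaBound φ
formulaBound (∃' k x φ) = formulaBound φ

mutual
  termBelow : ∀ t {B} → termBound t ≤ B → TermBelow B t
  termBelow ω            _ = tt
  termBelow (app k x ts) b = m⊔n≤o⇒m≤o (suc x) (termsBound ts) b , termsBelow ts (m⊔n≤o⇒n≤o (suc x) _ b)

  termsBelow : ∀ {m} (ts : Vec Term m) {B} → termsBound ts ≤ B → TermsBelow B ts
  termsBelow []       _ = tt
  termsBelow (t ∷ ts) b = termBelow t (m⊔n≤o⇒m≤o _ _ b) , termsBelow ts (m⊔n≤o⇒n≤o _ _ b)

formulaBelow : ∀ φ {B} → formulaBound φ ≤ B → FormulaBelow B φ
formulaBelow (t ≐ q)    b = termBelow t (m⊔n≤o⇒m≤o _ _ b) , termBelow q (m⊔n≤o⇒n≤o _ _ b)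
formulaBelow (¬' φ)     b = formulaBelow φ b
formulaBelow (φ ∧' ψ)   b = formulaBelow φ (m⊔n≤o⇒m≤o _ _ b) , formulaBelow ψ (m⊔n≤o⇒n≤o _ _ b)
formulaBelow (φ ∨' ψ)   b = formulaBelow φ (m⊔n≤o⇒m≤o _ _ b) , formulaBelow ψ (m⊔n≤o⇒n≤o _ _ b)
formulaBelow (φ ⇒' ψ)   b = formulaBelow φ (m⊔n≤o⇒m≤o _ _ b) , formulaBelow ψ (m⊔n≤o⇒n≤o _ _ b)
formulaBelow (∀' k x φ) b = formulaBelow φ b
formulaBelow (∃' k x φ) b = formulaBelow φ b

module _ {B : ℕ} where

  mutual
    eval-agree : ∀ {σ τ} t → TermBelow B t → Agree (_< B) σ τ → eval σ t ≡ eval τ t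
    eval-agree ω            _              _     = refl
    eval-agree {σ} (app k x ts) (x<B , ts<B) σ≈τ =
      trans (strictApp-cong (agree σ≈τ k x x<B) (evalVec σ ts)) (cong (strictApp _) (evalVec-agree ts ts<B σ≈τ))

    evalVec-agree : ∀ {σ τ m} (ts : Vec Term m) → TermsBelow B ts → Agree (_< B) σ τ →
                    evalVec σ ts ≡ evalVec τ ts
    evalVec-agree []       _            _   = refl
    evalVec-agree (t ∷ ts) (t<B , ts<B) σ≈τ = cong₂ _∷_ (eval-agree t t<B σ≈τ) (evalVec-agree ts ts<B σ≈τ)

  ⊨-agree : ∀ {σ τ} φ → FormulaBelow B φ → Agree (_< B) σ τ → σ ⊨ φ → τ ⊨ φ
  ⊨-agree (t ≐ q)    (t<B , q<B) σ≈τ σ⊨ =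
    trans (sym (eval-agree t t<B σ≈τ)) (trans σ⊨ (eval-agree q q<B σ≈τ))
  ⊨-agree (¬' φ)     φ<B         σ≈τ σ⊨ = λ τ⊨ → σ⊨ (⊨-agree φ φ<B (agree-sym σ≈τ) τ⊨)
  ⊨-agree (φ ∧' ψ)   (φ<B , ψ<B) σ≈τ (σ⊨φ , σ⊨ψ) =
    ⊨-agree φ φ<B σ≈τ σ⊨φ , ⊨-agree ψ ψ<B σ≈τ σ⊨ψ
  ⊨-agree (φ ∨' ψ)   (φ<B , ψ<B) σ≈τ (inj₁ σ⊨) = inj₁ (⊨-agree φ φ<B σ≈τ σ⊨)
  ⊨-agree (φ ∨' ψ)   (φ<B , ψ<B) σ≈τ (inj₂ σ⊨) = inj₂ (⊨-agree ψ ψ<B σ≈τ σ⊨)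
  ⊨-agree (φ ⇒' ψ)   (φ<B , ψ<B) σ≈τ σ⊨ =
    λ τ⊨ → ⊨-agree ψ ψ<B σ≈τ (σ⊨ (⊨-agree φ φ<B (agree-sym σ≈τ) τ⊨))
  ⊨-agree (∀' k x φ) φ<B         σ≈τ σ⊨ =
    λ F → ⊨-agree φ φ<B (update-agree {k = k} {x} {F} σ≈τ (λ _ → refl)) (σ⊨ F)
  ⊨-agree (∃' k x φ) φ<B         σ≈τ (F , σ⊨) =
    F , ⊨-agree φ φ<B (update-agree {k = k} {x} {F} σ≈τ (λ _ → refl)) σ⊨

updateVec-agree : ∀ {n P σ τ} (V : Vocabulary n) xs {F F′} → Agree P σ τ → FunEq V F F′ →
                  Agree P (updateVec V σ xs F) (updateVec V τ xs F′)
updateVec-agree {zero}  V       xs σ≈τ F≈F′ = σ≈τ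
updateVec-agree {suc n} (r ∷ V) xs σ≈τ F≈F′ =
  updateVec-agree V (λ i → xs (suc i)) (update-agree σ≈τ (F≈F′ zero)) (λ i → F≈F′ (suc i))

∃ⁿ : ∀ {n} (ar : Fin n → ℕ) (xs : Fin n → ℕ) → Formula → Formula
∃ⁿ {zero}  ar xs ψ = ψ
∃ⁿ {suc n} ar xs ψ = ∃' (ar zero) (xs zero) (∃ⁿ (λ i → ar (suc i)) (λ i → xs (suc i)) ψ)

∀ⁿ : ∀ {n} (ar : Fin n → ℕ) (xs : Fin n → ℕ) → Formula → Formula
∀ⁿ {zero}  ar xs ψ = ψ
∀ⁿ {suc n} ar xs ψ = ∀' (ar zero) (xs zero) (∀ⁿ (λ i → ar (suc i)) (λ i → xs (suc i)) ψ)

⋀ : ∀ {n} → (Fin n → Formula) → Formula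
⋀ {zero}  ψ = ω ≐ ω
⋀ {suc n} ψ = ψ zero ∧' ⋀ (λ i → ψ (suc i))

⊨∃ⁿ⁺ : ∀ {n} (ar xs : Fin n → ℕ) ψ {σ} (Fs : (i : Fin n) → AFun (ar i)) →
       updates ar σ xs Fs ⊨ ψ → σ ⊨ ∃ⁿ ar xs ψ
⊨∃ⁿ⁺ {zero}  ar xs ψ Fs ⊨ψ = ⊨ψ
⊨∃ⁿ⁺ {suc n} ar xs ψ Fs ⊨ψ =
  Fs zero , ⊨∃ⁿ⁺ (λ i → ar (suc i)) (λ i → xs (suc i)) ψ (λ i → Fs (suc i)) ⊨ψ

⊨∃ⁿ⁻ : ∀ {n} (ar xs : Fin n → ℕ) ψ {σ} → σ ⊨ ∃ⁿ ar xs ψ →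
       Σ ((i : Fin n) → AFun (ar i)) λ Fs → updates ar σ xs Fs ⊨ ψ
⊨∃ⁿ⁻ {zero}  ar xs ψ ⊨ψ = (λ ()) , ⊨ψ
⊨∃ⁿ⁻ {suc n} ar xs ψ (F , ⊨∃) with ⊨∃ⁿ⁻ (λ i → ar (suc i)) (λ i → xs (suc i)) ψ ⊨∃
... | Fs , ⊨ψ = (λ { zero → F ; (suc i) → Fs i }) , ⊨ψ

⊨∀ⁿ⁺ : ∀ {n} (ar xs : Fin n → ℕ) ψ {σ} →
       (∀ (Fs : (i : Fin n) → AFun (ar i)) → updates ar σ xs Fs ⊨ ψ) → σ ⊨ ∀ⁿ ar xs ψ
⊨∀ⁿ⁺ {zero}  ar xs ψ ⊨ψ = ⊨ψ (λ ())
⊨∀ⁿ⁺ {suc n} ar xs ψ ⊨ψ F =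
  ⊨∀ⁿ⁺ (λ i → ar (suc i)) (λ i → xs (suc i)) ψ λ Fs → ⊨ψ (λ { zero → F ; (suc i) → Fs i })

⊨∀ⁿ⁻ : ∀ {n} (ar xs : Fin n → ℕ) ψ {σ} → σ ⊨ ∀ⁿ ar xs ψ →
       ∀ (Fs : (i : Fin n) → AFun (ar i)) → updates ar σ xs Fs ⊨ ψ
⊨∀ⁿ⁻ {zero}  ar xs ψ ⊨∀ Fs = ⊨∀
⊨∀ⁿ⁻ {suc n} ar xs ψ ⊨∀ Fs =
  ⊨∀ⁿ⁻ (λ i → ar (suc i)) (λ i → xs (suc i)) ψ (⊨∀ (Fs zero)) (λ i → Fs (suc i))

⊨⋀⁺ : ∀ {n σ} (ψ : Fin n → Formula) → (∀ i → σ ⊨ ψ i) → σ ⊨ ⋀ ψ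
⊨⋀⁺ {zero}  ψ ⊨ψ = refl
⊨⋀⁺ {suc n} ψ ⊨ψ = ⊨ψ zero , ⊨⋀⁺ (λ i → ψ (suc i)) (λ i → ⊨ψ (suc i))

⊨⋀⁻ : ∀ {n σ} (ψ : Fin n → Formula) → σ ⊨ ⋀ ψ → ∀ i → σ ⊨ ψ i
⊨⋀⁻ ψ (⊨ψ₀ , _) zero    = ⊨ψ₀
⊨⋀⁻ ψ (_ , ⊨ψₛ) (suc i) = ⊨⋀⁻ (λ i → ψ (suc i)) ⊨ψₛ i

Defined : Val → Set
Defined v = ¬ v ≡ nothing

defined⇒just : ∀ {v} → Defined v → ∃ λ a → v ≡ just a
defined⇒just {just a}  _  = a , refl
defined⇒just {nothing} d = ⊥-elim (d refl)

just-defined : ∀ {v a} → v ≡ just a → Defined v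
just-defined refl ()

constant : Atom → AFun 0
constant a = afun (λ _ → just a) ([] ∷ [] , λ { [] _ → here refl })

sliceAt : ∀ {k} → Atom → AFun (suc k) → AFun k
sliceAt t F = afun (λ v → fun F (t ∷ v))
  (map tail (proj₁ (finite F)) , λ v d → ∈-map⁺ tail (proj₂ (finite F) (t ∷ v) d))

module _ (VL : List Atom) where

  indicator : Vec Atom 1 → Val
  indicator (t ∷ []) with t ∈? VL
  ... | yes _ = just 0
  ... | no _  = nothing

  indicator-∈ : ∀ {t} → t ∈ VL → indicator (t ∷ []) ≡ just 0
  indicator-∈ {t} t∈VL with t ∈? VL
  ... | yes _    = refl
  ... | no t∉VL = ⊥-elim (t∉VL t∈VL)

  indicator-defined : ∀ {t} → Defined (indicator (t ∷ [])) → t ∈ VL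
  indicator-defined {t} d with t ∈? VL
  ... | yes t∈VL = t∈VL
  ... | no _     = ⊥-elim (d refl)

  member : AFun 1
  member = afun indicator (map (_∷ []) VL , λ { (t ∷ []) d → ∈-map⁺ (_∷ []) (indicator-defined d) })

module _ (m : ℕ) where

  successorBelow : Vec Atom 1 → Val
  successorBelow (t ∷ []) with t <? m
  ... | yes _ = just (suc t)
  ... | no _  = nothing

  successorBelow-< : ∀ {t} → t < m → successorBelow (t ∷ []) ≡ just (suc t)
  successorBelow-< {t} t<m with t <? m
  ... | yes _   = refl
  ... | no t≮m = ⊥-elim (t≮m t<m)

  successorBelow-just : ∀ {t u} → successorBelow (t ∷ []) ≡ just u → t < m × suc t ≡ u
  successorBelow-just {t} eq with t <? m
  successorBelow-just refl | yes t<m = t<m , refl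

  successorBelow-defined : ∀ {t} → Defined (successorBelow (t ∷ [])) → t < m
  successorBelow-defined d = proj₁ (successorBelow-just (proj₂ (defined⇒just d)))

  counter : AFun 1
  counter = afun successorBelow
    (map (_∷ []) (upTo m) , λ { (t ∷ []) d → ∈-map⁺ (_∷ []) (∈-upTo⁺ (successorBelow-defined d)) })

module _ {k} (m : ℕ) (p : ℕ → AFun k) where

  stackFun : Vec Atom (suc k) → Val
  stackFun (t ∷ v) with t ≤? m
  ... | yes _ = fun (p t) v
  ... | no _  = nothing

  stackFun-≤ : ∀ {t} v → t ≤ m → stackFun (t ∷ v) ≡ fun (p t) v
  stackFun-≤ {t} v t≤m with t ≤? m
  ... | yes _   = refl
  ... | no t≰m = ⊥-elim (t≰m t≤m)

  stackFun-defined : ∀ {t} v → Defined (stackFun (t ∷ v)) → t ≤ m × Defined (fun (p t) v)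
  stackFun-defined {t} v d with t ≤? m
  ... | yes t≤m = t≤m , d
  ... | no _    = ⊥-elim (d refl)

  stack : AFun (suc k)
  stack = afun stackFun (domain , inDomain)
    where
      domain : List (Vec Atom (suc k))
      domain = concatMap (λ t → map (t ∷_) (proj₁ (finite (p t)))) (upTo (suc m))

      inDomain : ∀ tv → Defined (stackFun tv) → tv ∈ domain
      inDomain (t ∷ v) d with stackFun-defined v d
      ... | t≤m , d′ = ∈-concatMap⁺ _ (lose (∈-upTo⁺ (s≤s t≤m)) (∈-map⁺ (t ∷_) (proj₂ (finite (p t)) v d′)))

  slice-stack : ∀ {t} → t ≤ m → fun (sliceAt t stack) ≗ fun (p t)
  slice-stack t≤m v = stackFun-≤ v t≤m

-- Orbits of a partial unary function with finite domain

module Orbit (s : ℕ → Maybe ℕ) (L : List ℕ) (s-dom : ∀ {t u} → s t ≡ just u → t ∈ L) where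

  N : ℕ
  N = length L

  iterate : ℕ → ℕ → Maybe ℕ
  iterate a zero    = just a
  iterate a (suc m) = iterate a m >>= s

  Closed : List ℕ → Set
  Closed VL = ∀ {t u} → t ∈ VL → s t ≡ just u → u ∈ VL

  iterate-suc : ∀ a m {u} → iterate a (suc m) ≡ just u → ∃ λ t → iterate a m ≡ just t × s t ≡ just u
  iterate-suc a m eq with iterate a m
  ... | just t = t , refl , eq

  iterate-≤ : ∀ a {k m u} → k ≤ m → iterate a m ≡ just u → ∃ λ t → iterate a k ≡ just t
  iterate-≤ a {m = zero}  z≤n eq = _ , eq
  iterate-≤ a {m = suc m} k≤m eq with m≤n⇒m<n∨m≡n k≤m
  ... | inj₂ refl = _ , eq
  ... | inj₁ k<m  = iterate-≤ a (≤-pred k<m) (proj₁ (proj₂ (iterate-suc a m eq)))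

  iterate-shift : ∀ a {i j} → iterate a i ≡ iterate a j → ∀ d → iterate a (d + i) ≡ iterate a (d + j)
  iterate-shift a eq zero    = eq
  iterate-shift a eq (suc d) = cong (_>>= s) (iterate-shift a eq d)

  orbit : ℕ → ℕ → List ℕ
  orbit a zero    = a ∷ []
  orbit a (suc m) = fromMaybe (iterate a (suc m)) ++ orbit a m

  orbit⁺ : ∀ a {j m t} → j ≤ m → iterate a j ≡ just t → t ∈ orbit a m
  orbit⁺ a {zero}  {zero}  z≤n refl = here refl
  orbit⁺ a {j}     {suc m} j≤m eq with m≤n⇒m<n∨m≡n j≤m
  ... | inj₁ j<m  = ∈-++⁺ʳ (fromMaybe (iterate a (suc m))) (orbit⁺ a (≤-pred j<m) eq)
  ... | inj₂ refl rewrite eq = here refl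

  orbit⁻ : ∀ a m {t} → t ∈ orbit a m → ∃ λ j → j ≤ m × iterate a j ≡ just t
  orbit⁻ a zero    (here refl) = zero , z≤n , refl
  orbit⁻ a (suc m) t∈ with iterate a (suc m) in eq | ∈-++⁻ (fromMaybe (iterate a (suc m))) t∈
  ... | just _ | inj₁ (here refl) = suc m , ≤-refl , eq
  ... | _      | inj₂ t∈orbit with orbit⁻ a m t∈orbit
  ... | j , j≤m , eqj = j , ≤-trans j≤m (n≤1+n m) , eqj

  -- Iterates 0 … N all lie in the domain L of s, which has only N elements, so two of them coincide
  -- and the orbit repeats itself before step N + 1.
  iterate-1+N∈orbit : ∀ a {u} → iterate a (suc N) ≡ just u → u ∈ orbit a N
  iterate-1+N∈orbit a {u} eq = repetition (pigeonhole ≤-refl position)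
    where
      iterate∈L : (k : Fin (suc N)) → ∃ λ t → iterate a (toℕ k) ≡ just t × t ∈ L
      iterate∈L k with iterate-≤ a (toℕ<n k) eq
      ... | _ , eq′ with iterate-suc a (toℕ k) eq′
      ... | t , eqt , st = t , eqt , s-dom st

      element-∈ : (k : Fin (suc N)) → proj₁ (iterate∈L k) ∈ L
      element-∈ k = proj₂ (proj₂ (iterate∈L k))

      position : Fin (suc N) → Fin N
      position k = index (element-∈ k)

      iterates-agree : ∀ i j → position i ≡ position j → iterate a (toℕ i) ≡ iterate a (toℕ j)
      iterates-agree i j same =
        trans (proj₁ (proj₂ (iterate∈L i)))
              (trans (cong just (trans (lookup-index (element-∈ i))
                                       (trans (cong (Data.List.lookup L) same) (sym (lookup-index (element-∈ j))))))
                     (sym (proj₁ (proj₂ (iterate∈L j)))))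

      repetition : ∃₂ (λ i j → i Data.Fin.< j × position i ≡ position j) → u ∈ orbit a N
      repetition (i , j , i<j , same) = orbit⁺ a d+i≤N (trans (sym shifted) eq)
        where
          d = suc N ∸ toℕ j

          d+j≡1+N : d + toℕ j ≡ suc N
          d+j≡1+N = m∸n+n≡m (<⇒≤ (toℕ<n j))

          shifted : iterate a (suc N) ≡ iterate a (d + toℕ i)
          shifted = trans (cong (iterate a) (sym d+j≡1+N)) (sym (iterate-shift a (iterates-agree i j same) d))

          d+i≤N : d + toℕ i ≤ N
          d+i≤N = ≤-pred (subst (suc (d + toℕ i) ≤_) d+j≡1+N (+-monoʳ-< d i<j))

  orbit-closed : ∀ a → Closed (orbit a N)
  orbit-closed a t∈ st with orbit⁻ a N t∈
  ... | j , j≤N , eq with m≤n⇒m<n∨m≡n j≤N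
  ... | inj₁ j<N  = orbit⁺ a j<N (trans (cong (_>>= s) eq) st)
  ... | inj₂ refl = iterate-1+N∈orbit a (trans (cong (_>>= s) eq) st)

  reachable : ∀ a b → (∀ VL → a ∈ VL → Closed VL → b ∈ VL) → ∃ λ m → iterate a m ≡ just b
  reachable a b b∈closed with orbit⁻ a N (b∈closed (orbit a N) (orbit⁺ a {m = N} z≤n refl) (orbit-closed a))
  ... | m , _ , eq = m , eq

-- Chains of vectors read off a table

module _ {n} (V : Vocabulary n) where

  Table : Set
  Table = (i : Fin n) → AFun (suc (lookup V i))

  slice : Atom → Table → FunVec V
  slice t H i = sliceAt t (H i)

  RespectsFunEq : (FunVec V → FunVec V → Set) → Set
  RespectsFunEq R = ∀ {F F′ G G′} → FunEq V F F′ → FunEq V G G′ → R F G → R F′ G′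

_⟨_⟩ : AFun 1 → Val → Val
F ⟨ v ⟩ = strictApp (fun F) (v ∷ [])

⟨⟩-defined : ∀ F {v} → Defined (F ⟨ v ⟩) → ∃ λ t → v ≡ just t
⟨⟩-defined F {just t}  _ = t , refl
⟨⟩-defined F {nothing} d = ⊥-elim (d refl)

ClosedUnder : AFun 1 → AFun 1 → Set
ClosedUnder S P = ∀ {t u} → Defined (fun P (t ∷ [])) → fun S (t ∷ []) ≡ just u → Defined (fun P (u ∷ []))

Reaches : AFun 1 → Atom → Atom → Set
Reaches S a b = ∀ (P : AFun 1) → Defined (fun P (a ∷ [])) → ClosedUnder S P → Defined (fun P (b ∷ []))

counter-reaches : ∀ m → Reaches (counter m) 0 m
counter-reaches m P P0 closed = reached m ≤-refl
  where
    reached : ∀ j → j ≤ m → Defined (fun P (j ∷ []))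
    reached zero    _   = P0
    reached (suc j) j<m = closed (reached j (<⇒≤ j<m)) (successorBelow-< m j<m)

closedUnder⁺ : ∀ {S P} →
               (∀ t → Defined (fun P (t ∷ [])) → Defined (fun S (t ∷ [])) → Defined (P ⟨ fun S (t ∷ []) ⟩)) →
               ClosedUnder S P
closedUnder⁺ {P = P} closed {t} dPt eq = subst (λ w → Defined (P ⟨ w ⟩)) eq (closed t dPt (just-defined eq))

closedUnder⁻ : ∀ {S P} → ClosedUnder S P →
               ∀ v → Defined (P ⟨ v ⟩) → Defined (S ⟨ v ⟩) → Defined (P ⟨ S ⟨ v ⟩ ⟩)
closedUnder⁻ {S} {P} closed nothing  dPv dSv = ⊥-elim (dPv refl)
closedUnder⁻ {S} {P} closed (just t) dPt dSt with defined⇒just dSt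
... | u , eq = subst (λ w → Defined (P ⟨ w ⟩)) (sym eq) (closed dPt eq)

record Chain {n} (V : Vocabulary n) (R : FunVec V → FunVec V → Set) (F G : FunVec V) : Set where
  field
    next       : AFun 1
    start end  : Atom
    table      : Table V
    starts     : FunEq V (slice V start table) F
    ends       : FunEq V (slice V end table) G
    reaches    : Reaches next start end
    steps      : ∀ {t u} → fun next (t ∷ []) ≡ just u → R (slice V t table) (slice V u table)

record Walk {n} (V : Vocabulary n) (R : FunVec V → FunVec V → Set) (F G : FunVec V) : Set where
  field
    size   : ℕ
    vertex : ℕ → FunVec V
    first  : vertex 0 ≡ F
    last   : FunEq V (vertex size) G
    edge   : ∀ {j} → j < size → R (vertex j) (vertex (suc j))

module _ {n} {V : Vocabulary n} {R : FunVec V → FunVec V → Set} where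

  Star→Walk : ∀ {F G} → Star V R F G → Walk V R F G
  Star→Walk {F} (base F≈G) = record { size = 0 ; vertex = λ _ → F ; first = refl ; last = F≈G ; edge = λ () }
  Star→Walk {F} (step r s) = record
    { size = suc size ; vertex = vertex′ ; first = refl ; last = last ; edge = edge′ }
    where
      open Walk (Star→Walk s)
      vertex′ : ℕ → FunVec V
      vertex′ zero    = F
      vertex′ (suc j) = vertex j
      edge′ : ∀ {j} → j < suc size → R (vertex′ j) (vertex′ (suc j))
      edge′ {zero}  _         = subst (R F) (sym first) r
      edge′ {suc j} (s≤s j<l) = edge j<l

module _ {n} {V : Vocabulary n} {R : FunVec V → FunVec V → Set} (resp : RespectsFunEq V R) where

  private
    respˡ : ∀ {F F′ G} → FunEq V F F′ → R F G → R F′ G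
    respˡ {G = G} F≈F′ = resp {G = G} {G′ = G} F≈F′ (λ _ _ → refl)

  star-endpoints : ∀ {F F′ G G′} → FunEq V F F′ → FunEq V G G′ → Star V R F G → Star V R F′ G′
  star-endpoints F≈F′ G≈G′ (base F≈G) = base λ i x → trans (sym (F≈F′ i x)) (trans (F≈G i x) (G≈G′ i x))
  star-endpoints F≈F′ G≈G′ (step r s) = step (respˡ F≈F′ r) (star-endpoints (λ _ _ → refl) G≈G′ s)

  star-snoc : ∀ {F G H} → Star V R F G → R G H → Star V R F H
  star-snoc (base F≈G)  r = step (respˡ (λ i x → sym (F≈G i x)) r) (base λ _ _ → refl)
  star-snoc (step r′ s) r = step r′ (star-snoc s r)

  Chain→Star : ∀ {F G} → Chain V R F G → Star V R F G
  Chain→Star c = star-endpoints starts ends (uncurry walk (reachable start end closed⇒end))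
    where
      open Chain c
      s : ℕ → Maybe ℕ
      s t = fun next (t ∷ [])
      s-dom : ∀ {t u} → s t ≡ just u → t ∈ map head (proj₁ (finite next))
      s-dom eq = ∈-map⁺ head (proj₂ (finite next) (_ ∷ []) (just-defined eq))
      open Orbit s (map head (proj₁ (finite next))) s-dom

      closed⇒end : ∀ VL → start ∈ VL → Closed VL → end ∈ VL
      closed⇒end VL start∈ closed =
        indicator-defined VL (reaches (member VL) (just-defined (indicator-∈ VL start∈))
          λ d eq → just-defined (indicator-∈ VL (closed (indicator-defined VL d) eq)))

      walk : ∀ {t} m → iterate start m ≡ just t → Star V R (slice V start table) (slice V t table)
      walk zero    refl = base λ _ _ → refl
      walk (suc m) eq with iterate-suc start m eq
      ... | t , eqt , st = star-snoc (walk m eqt) (steps st)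

  Walk→Chain : ∀ {F G} → Walk V R F G → Chain V R F G
  Walk→Chain {F} {G} w = record
    { next    = counter size
    ; start   = 0
    ; end     = size
    ; table   = table
    ; starts  = λ i x → trans (slice-stack size (λ t → vertex t i) z≤n x) (cong (λ H → fun (H i) x) first)
    ; ends    = λ i x → trans (slice-stack size (λ t → vertex t i) ≤-refl x) (last i x)
    ; reaches = counter-reaches size
    ; steps   = steps
    }
    where
      open Walk w
      table : Table V
      table i = stack size (λ t → vertex t i)

      slice≈vertex : ∀ {t} → t ≤ size → FunEq V (vertex t) (slice V t table)
      slice≈vertex t≤l i x = sym (slice-stack size (λ t → vertex t i) t≤l x)

      steps : ∀ {t u} → fun (counter size) (t ∷ []) ≡ just u → R (slice V t table) (slice V u table)
      steps eq with successorBelow-just size eq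
      ... | t<l , refl = resp (slice≈vertex (<⇒≤ t<l)) (slice≈vertex t<l) (edge t<l)

  Chain⇔Star : ∀ {F G} → Chain V R F G ⇔ Star V R F G
  Chain⇔Star = mk⇔ Chain→Star (λ s → Walk→Chain (Star→Walk s))

-- The formula φ*

maxOf : ∀ {n} → (Fin n → ℕ) → ℕ
maxOf {zero}  f = 0
maxOf {suc n} f = f zero ⊔ maxOf (λ i → f (suc i))

≤-maxOf : ∀ {n} (f : Fin n → ℕ) i → f i ≤ maxOf f
≤-maxOf f zero    = m≤m⊔n _ _
≤-maxOf f (suc i) = ≤-trans (≤-maxOf (λ i → f (suc i)) i) (m≤n⊔m (f zero) _)

var⁰ : ℕ → Term
var⁰ x = app 0 x []

evalVec-tabulate : ∀ {m} σ (ts : Fin m → Term) → evalVec σ (tabulate ts) ≡ tabulate (λ j → eval σ (ts j))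
evalVec-tabulate {zero}  σ ts = refl
evalVec-tabulate {suc m} σ ts = cong (eval σ (ts zero) ∷_) (evalVec-tabulate σ (λ j → ts (suc j)))

value-cong : ∀ {F G : AFun 0} → F ≡ G → fun F [] ≡ fun G []
value-cong = cong (λ F → fun F [])

defined : Term → Formula
defined c = ¬' (c ≐ ω)

module StarFormula {n} (V : Vocabulary n) (fs gs : VarVec V) (distinct : Distinct V fs gs) (φ : Formula) where

  r : Fin n → ℕ
  r = lookup V

  B : ℕ
  B = suc (formulaBound φ ⊔ (maxOf fs ⊔ maxOf gs))

  fs<B : ∀ i → fs i < B
  fs<B i = s≤s (≤-trans (≤-maxOf fs i) (≤-trans (m≤m⊔n (maxOf fs) (maxOf gs)) (m≤n⊔m (formulaBound φ) _)))

  gs<B : ∀ i → gs i < B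
  gs<B i = s≤s (≤-trans (≤-maxOf gs i) (≤-trans (m≤n⊔m (maxOf fs) (maxOf gs)) (m≤n⊔m (formulaBound φ) _)))

  φ<B : FormulaBelow B φ
  φ<B = formulaBelow φ (≤-trans (m≤m⊔n (formulaBound φ) _) (n≤1+n _))

  fresh : ℕ → ℕ
  fresh c = B + c

  fresh-≢ : ∀ {c c′} → c ≢ c′ → fresh c ≢ fresh c′
  fresh-≢ c≢c′ eq = c≢c′ (+-cancelˡ-≡ B _ _ eq)

  fresh≮B : ∀ c → ¬ fresh c < B
  fresh≮B c lt = <⇒≱ lt (m≤m+n B c)

  sName aName bName tName pName : ℕ
  sName = fresh 0
  aName = fresh 1
  bName = fresh 2
  tName = fresh 3
  pName = fresh 4

  -- The names of the table h⃗ and of the bound atoms x⃗ overlap; they are told apart by arity.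
  hName : Fin n → ℕ
  hName i = fresh (5 + toℕ i)

  xName : ∀ {k} → Fin k → ℕ
  xName j = fresh (5 + toℕ j)

  xName-distinct : ∀ {k} → DistinctNames {k} (λ _ → 0) xName
  xName-distinct i j _ eq = toℕ-injective (+-cancelˡ-≡ 5 _ _ (+-cancelˡ-≡ B _ _ eq))

  xName≮fresh5 : ∀ {k} (j : Fin k) → ¬ xName j < fresh 5
  xName≮fresh5 j lt = <⇒≱ lt (+-monoʳ-≤ B (m≤m+n 5 (toℕ j)))

  fresh<fresh5 : ∀ {c} → c < 5 → fresh c < fresh 5
  fresh<fresh5 = +-monoʳ-< B

  fs-distinct : DistinctNames r fs
  fs-distinct i j p q with distinct (inj₁ i) (inj₁ j) (cong₂ _,_ p q)
  ... | refl = refl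

  gs-distinct : DistinctNames r gs
  gs-distinct i j p q with distinct (inj₂ i) (inj₂ j) (cong₂ _,_ p q)
  ... | refl = refl

  gs≢fs : ∀ i j → r j ≡ r i → gs j ≡ fs i → ⊥
  gs≢fs i j p q with distinct (inj₂ j) (inj₁ i) (cong₂ _,_ p q)
  ... | ()

  aT bT tT : Term
  aT = var⁰ aName
  bT = var⁰ bName
  tT = var⁰ tName

  s· p· : Term → Term
  s· c = app 1 sName (c ∷ [])
  p· c = app 1 pName (c ∷ [])

  aT<fresh5 : TermBelow (fresh 5) aT
  aT<fresh5 = fresh<fresh5 (s≤s (s≤s z≤n)) , tt

  bT<fresh5 : TermBelow (fresh 5) bT
  bT<fresh5 = fresh<fresh5 (s≤s (s≤s (s≤s z≤n))) , tt

  tT<fresh5 : TermBelow (fresh 5) tT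
  tT<fresh5 = fresh<fresh5 (s≤s (s≤s (s≤s (s≤s z≤n)))) , tt

  sT<fresh5 : TermBelow (fresh 5) (s· tT)
  sT<fresh5 = fresh<fresh5 (s≤s z≤n) , tT<fresh5 , tt

  xVars : (k : ℕ) → Vec Term k
  xVars k = tabulate (λ j → var⁰ (xName j))

  sliceEquation : (Fin n → ℕ) → Term → Fin n → Formula
  sliceEquation xs c i = app (r i) (xs i) (xVars (r i)) ≐ app (suc (r i)) (hName i) (c ∷ xVars (r i))

  SliceIs : (Fin n → ℕ) → Term → Formula
  SliceIs xs c = ⋀ λ i → ∀ⁿ {r i} (λ _ → 0) xName (sliceEquation xs c i)

  ClosedF ReachF StepBody StepF Body φ* : Formula
  ClosedF  = ∀' 0 tName (defined (p· tT) ⇒' (defined (s· tT) ⇒' defined (p· (s· tT))))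
  ReachF   = ∀' 1 pName ((defined (p· aT) ∧' ClosedF) ⇒' defined (p· bT))
  StepBody = SliceIs fs tT ∧' (SliceIs gs (s· tT) ∧' φ)
  StepF    = ∀' 0 tName (defined (s· tT) ⇒' ∃ⁿ r fs (∃ⁿ r gs StepBody))
  Body     = defined aT ∧' (defined bT ∧' (SliceIs fs aT ∧' (SliceIs gs bT ∧' (ReachF ∧' StepF))))
  φ*       = ∃' 1 sName (∃' 0 aName (∃' 0 bName (∃ⁿ (λ i → suc (r i)) hName Body)))

  module _ {τ : Structure} {xs : Fin n → ℕ} {c : Term} {c₀ : Atom} {H : Table V} (Fs : FunVec V)
           (xs<B : ∀ i → xs i < B) (c<fresh5 : TermBelow (fresh 5) c) (eval-c : eval τ c ≡ just c₀)
           (τ-xs : ∀ i → fun (τ (r i) (xs i)) ≗ fun (Fs i)) (τ-h : ∀ i → τ (suc (r i)) (hName i) ≡ H i) where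

    private
      module AtAtoms (i : Fin n) (X : Fin (r i) → AFun 0) where
        τX : Structure
        τX = updates (λ _ → 0) τ xName X

        args : Vec Val (r i)
        args = tabulate (λ j → fun (X j) [])

        eval-xVars : evalVec τX (xVars (r i)) ≡ args
        eval-xVars = trans (evalVec-tabulate τX (λ j → var⁰ (xName j)))
          (tabulate-cong λ j → value-cong (updates-same (λ _ → 0) τ xName X xName-distinct j))

        ⊨sliceEquation⇔ : τX ⊨ sliceEquation xs c i ⇔
                          strictApp (fun (Fs i)) args ≡ strictApp (fun (slice V c₀ H i)) args
        ⊨sliceEquation⇔ = mk⇔ (λ eq → trans (sym eval-lhs) (trans eq eval-rhs))
                              (λ eq → trans eval-lhs (trans eq (sym eval-rhs)))
          where
            τX-xs : fun (τX (r i) (xs i)) ≗ fun (Fs i)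
            τX-xs v = trans (cong (λ F → fun F v) (updates-other (λ _ → 0) τ xName X xs≢xName)) (τ-xs i v)
              where
                xs≢xName : ∀ j → 0 ≡ r i → xName j ≡ xs i → ⊥
                xs≢xName j _ eq = fresh≮B _ (subst (_< B) (sym eq) (xs<B i))

            eval-lhs : eval τX (app (r i) (xs i) (xVars (r i))) ≡ strictApp (fun (Fs i)) args
            eval-lhs = trans (strictApp-cong τX-xs (evalVec τX (xVars (r i)))) (cong (strictApp (fun (Fs i))) eval-xVars)

            eval-c′ : eval τX c ≡ just c₀
            eval-c′ = trans (sym (eval-agree c c<fresh5 (updates-fresh (λ _ → 0) τ xName X xName≮fresh5))) eval-c

            -- Applied to the defined first argument c₀, hᵢ is definitionally its c₀-slice.
            eval-rhs : eval τX (app (suc (r i)) (hName i) (c ∷ xVars (r i))) ≡ strictApp (fun (slice V c₀ H i)) args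
            eval-rhs = cong₂ (λ F vs → strictApp (fun F) vs)
                             (trans (updates-other (λ _ → 0) τ xName X λ _ ()) (τ-h i))
                             (cong₂ _∷_ eval-c′ eval-xVars)

    ⊨SliceIs⇔ : τ ⊨ SliceIs xs c ⇔ FunEq V (slice V c₀ H) Fs
    ⊨SliceIs⇔ = mk⇔ to from
      where
        to : τ ⊨ SliceIs xs c → FunEq V (slice V c₀ H) Fs
        to ⊨slice i v = begin
          fun (slice V c₀ H i) v                  ≡⟨ strictApp-atoms (fun (slice V c₀ H i)) v ⟨
          strictApp (fun (slice V c₀ H i)) args   ≡⟨ Equivalence.to ⊨sliceEquation⇔ ⊨atV ⟨
          strictApp (fun (Fs i)) args             ≡⟨ strictApp-atoms (fun (Fs i)) v ⟩
          fun (Fs i) v                            ∎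
          where
            open ≡-Reasoning
            open AtAtoms i (λ j → constant (lookup v j))
            ⊨atV = ⊨∀ⁿ⁻ (λ _ → 0) xName _ (⊨⋀⁻ _ ⊨slice i) (λ j → constant (lookup v j))

        from : FunEq V (slice V c₀ H) Fs → τ ⊨ SliceIs xs c
        from slice≈Fs = ⊨⋀⁺ _ λ i → ⊨∀ⁿ⁺ (λ _ → 0) xName _ λ X → let open AtAtoms i X in
          Equivalence.from ⊨sliceEquation⇔ (strictApp-cong (λ v → sym (slice≈Fs i v)) args)

  module Witnessed (σ : Structure) (S : AFun 1) (α β : AFun 0) (H : Table V) where

    τ₁ τ₂ τ₀ τ : Structure
    τ₁ = update σ 1 sName S
    τ₂ = update τ₁ 0 aName α
    τ₀ = update τ₂ 0 bName β
    τ  = updates (λ i → suc (r i)) τ₀ hName H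

    private
      τ≡τ₀ : ∀ {k x} → x < fresh 5 → τ k x ≡ τ₀ k x
      τ≡τ₀ x<5 = updates-other _ τ₀ hName H λ j _ eq → xName≮fresh5 j (subst (_< fresh 5) (sym eq) x<5)

    τ-s : τ 1 sName ≡ S
    τ-s = trans (τ≡τ₀ (fresh<fresh5 (s≤s z≤n)))
                (trans (update-other τ₂ bName β 1 sName λ _ → fresh-≢ λ ())
                       (trans (update-other τ₁ aName α 1 sName λ _ → fresh-≢ λ ()) (update-same σ sName S)))

    τ-a : τ 0 aName ≡ α
    τ-a = trans (τ≡τ₀ (fresh<fresh5 (s≤s (s≤s z≤n))))
                (trans (update-other τ₂ bName β 0 aName λ _ → fresh-≢ λ ()) (update-same τ₁ aName α))

    τ-b : τ 0 bName ≡ β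
    τ-b = trans (τ≡τ₀ (fresh<fresh5 (s≤s (s≤s (s≤s z≤n))))) (update-same τ₂ bName β)

    τ-h : ∀ i → τ (suc (r i)) (hName i) ≡ H i
    τ-h = updates-same _ τ₀ hName H λ i j _ eq → xName-distinct i j refl eq

    σ≈τ : Agree (_< B) σ τ
    σ≈τ = agree-trans (update-fresh σ 1 sName S (fresh≮B 0))
            (agree-trans (update-fresh τ₁ 0 aName α (fresh≮B 1))
              (agree-trans (update-fresh τ₂ 0 bName β (fresh≮B 2))
                (updates-fresh _ τ₀ hName H λ j → fresh≮B (5 + toℕ j))))

    module _ {a₀ b₀} (eval-a : eval τ aT ≡ just a₀) (eval-b : eval τ bT ≡ just b₀) where

      private
        module WithP (P : AFun 1) where
          τP : Structure
          τP = update τ 1 pName P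

          τP-p : τP 1 pName ≡ P
          τP-p = update-same τ pName P

          eval-pa : eval τP (p· aT) ≡ fun P (a₀ ∷ [])
          eval-pa = cong₂ _⟨_⟩ τP-p (trans (value-cong (update-other τ pName P 0 aName λ ())) eval-a)

          eval-pb : eval τP (p· bT) ≡ fun P (b₀ ∷ [])
          eval-pb = cong₂ _⟨_⟩ τP-p (trans (value-cong (update-other τ pName P 0 bName λ ())) eval-b)

          module WithT (T : AFun 0) where
            τPT : Structure
            τPT = update τP 0 tName T

            eval-t : eval τPT tT ≡ fun T []
            eval-t = value-cong (update-same τP tName T)

            τPT-p : τPT 1 pName ≡ P
            τPT-p = trans (update-other τP tName T 1 pName λ ()) τP-p

            τPT-s : τPT 1 sName ≡ S
            τPT-s = trans (update-other τP tName T 1 sName λ ())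
                          (trans (update-other τ pName P 1 sName λ _ → fresh-≢ λ ()) τ-s)

            eval-pt : eval τPT (p· tT) ≡ P ⟨ fun T [] ⟩
            eval-pt = cong₂ _⟨_⟩ τPT-p eval-t

            eval-st : eval τPT (s· tT) ≡ S ⟨ fun T [] ⟩
            eval-st = cong₂ _⟨_⟩ τPT-s eval-t

            eval-pst : eval τPT (p· (s· tT)) ≡ P ⟨ S ⟨ fun T [] ⟩ ⟩
            eval-pst = cong₂ _⟨_⟩ τPT-p eval-st

      ⊨Reach⇔ : τ ⊨ ReachF ⇔ Reaches S a₀ b₀
      ⊨Reach⇔ = mk⇔ to from
        where
          to : τ ⊨ ReachF → Reaches S a₀ b₀
          to ⊨reach P dPa closed = subst Defined eval-pb (⊨reach P (subst Defined (sym eval-pa) dPa , closedAt))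
            where
              open WithP P
              closedAt : τP ⊨ ClosedF
              closedAt T dPt dSt = subst Defined (sym eval-pst)
                (closedUnder⁻ {S} {P} closed (fun T []) (subst Defined eval-pt dPt) (subst Defined eval-st dSt))
                where open WithT T

          from : Reaches S a₀ b₀ → τ ⊨ ReachF
          from reaches P (dPa , closedAt) = subst Defined (sym eval-pb)
            (reaches P (subst Defined eval-pa dPa) (closedUnder⁺ {S} {P} λ t dPt dSt →
              let open WithT (constant t) in
              subst Defined eval-pst
                (closedAt (constant t) (subst Defined (sym eval-pt) dPt) (subst Defined (sym eval-st) dSt))))
            where open WithP P

    Steps : Set
    Steps = ∀ {t u} → fun S (t ∷ []) ≡ just u → Rel V σ fs gs φ (slice V t H) (slice V u H)

    private
      module WithT (T : AFun 0) where
        τT : Structure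
        τT = update τ 0 tName T

        eval-sT : eval τT (s· tT) ≡ S ⟨ fun T [] ⟩
        eval-sT = cong₂ _⟨_⟩ (trans (update-other τ tName T 1 sName λ ()) τ-s) (value-cong (update-same τ tName T))

        module WithFG (F G : FunVec V) where
          τG : Structure
          τG = updates r (updates r τT fs F) gs G

          τG-fresh : ∀ {k} c → τG k (fresh c) ≡ τT k (fresh c)
          τG-fresh c = trans (updates-other r _ gs G λ j _ eq → fresh≮B c (subst (_< B) eq (gs<B j)))
                             (updates-other r τT fs F λ j _ eq → fresh≮B c (subst (_< B) eq (fs<B j)))

          τG-fs : ∀ i → fun (τG (r i) (fs i)) ≗ fun (F i)
          τG-fs i v = cong (λ F → fun F v)
            (trans (updates-other r _ gs G λ j p q → gs≢fs i j p q) (updates-same r τT fs F fs-distinct i))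

          τG-gs : ∀ i → fun (τG (r i) (gs i)) ≗ fun (G i)
          τG-gs i v = cong (λ F → fun F v) (updates-same r _ gs G gs-distinct i)

          τG-h : ∀ i → τG (suc (r i)) (hName i) ≡ H i
          τG-h i = trans (τG-fresh (5 + toℕ i)) (trans (update-other τ tName T _ _ λ _ → fresh-≢ λ ()) (τ-h i))

          eval-t : eval τG tT ≡ fun T []
          eval-t = value-cong (trans (τG-fresh 3) (update-same τ tName T))

          eval-s : eval τG (s· tT) ≡ S ⟨ fun T [] ⟩
          eval-s = cong₂ _⟨_⟩ (trans (τG-fresh 0) (trans (update-other τ tName T 1 sName λ ()) τ-s)) eval-t

          τG≈Rel : ∀ {F′ G′} → FunEq V F F′ → FunEq V G G′ →
                   Agree (_< B) τG (updateVec V (updateVec V σ fs F′) gs G′)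
          τG≈Rel {F′} {G′} F≈F′ G≈G′ =
            subst (Agree (_< B) τG)
                  (sym (trans (updateVec≡updates V _ gs G′)
                              (cong (λ ρ → updates r ρ gs G′) (updateVec≡updates V σ fs F′))))
                  (updates-agree r gs (updates-agree r fs τT≈σ F≈F′) G≈G′)
            where
              τT≈σ : Agree (_< B) τT σ
              τT≈σ = agree-sym (agree-trans σ≈τ (update-fresh τ 0 tName T (fresh≮B 3)))

    ⊨Step⇔ : τ ⊨ StepF ⇔ Steps
    ⊨Step⇔ = mk⇔ to from
      where
        to : τ ⊨ StepF → Steps
        to ⊨step {t} {u} eq =
          related (⊨∃ⁿ⁻ r fs _ (⊨step (constant t) (subst Defined (sym eval-sT) (just-defined {fun S (t ∷ [])} eq))))
          where
            open WithT (constant t)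

            related : Σ (FunVec V) (λ F → updates r τT fs F ⊨ ∃ⁿ r gs StepBody) →
                      Rel V σ fs gs φ (slice V t H) (slice V u H)
            related (F , ⊨∃G) with ⊨∃ⁿ⁻ r gs _ ⊨∃G
            ... | G , ⊨sliceF , ⊨sliceG , ⊨φ =
              ⊨-agree φ φ<B (τG≈Rel (λ i v → sym (t≈F i v)) (λ i v → sym (u≈G i v))) ⊨φ
              where
                open WithFG F G
                t≈F : FunEq V (slice V t H) F
                t≈F = Equivalence.to (⊨SliceIs⇔ F fs<B tT<fresh5 eval-t τG-fs τG-h) ⊨sliceF
                u≈G : FunEq V (slice V u H) G
                u≈G = Equivalence.to (⊨SliceIs⇔ G gs<B sT<fresh5 (trans eval-s eq) τG-gs τG-h) ⊨sliceG

        from : Steps → τ ⊨ StepF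
        from steps T dS = stepAt (⟨⟩-defined S {fun T []} (subst Defined eval-sT dS))
          where
            open WithT T

            stepAt : (∃ λ t → fun T [] ≡ just t) → τT ⊨ ∃ⁿ r fs (∃ⁿ r gs StepBody)
            stepAt (t , T≡t)
              with defined⇒just {fun S (t ∷ [])} (subst Defined (trans eval-sT (cong (S ⟨_⟩) T≡t)) dS)
            ... | u , eq = ⊨∃ⁿ⁺ r fs _ (slice V t H) (⊨∃ⁿ⁺ r gs _ (slice V u H) (⊨sliceF , ⊨sliceG , ⊨φ))
              where
                open WithFG (slice V t H) (slice V u H)
                eval-su : eval τG (s· tT) ≡ just u
                eval-su = trans eval-s (trans (cong (S ⟨_⟩) T≡t) eq)
                ⊨sliceF : τG ⊨ SliceIs fs tT
                ⊨sliceF = Equivalence.from (⊨SliceIs⇔ (slice V t H) fs<B tT<fresh5 (trans eval-t T≡t) τG-fs τG-h)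
                                           λ _ _ → refl
                ⊨sliceG : τG ⊨ SliceIs gs (s· tT)
                ⊨sliceG = Equivalence.from (⊨SliceIs⇔ (slice V u H) gs<B sT<fresh5 eval-su τG-gs τG-h)
                                           λ _ _ → refl
                ⊨φ : τG ⊨ φ
                ⊨φ = ⊨-agree φ φ<B (agree-sym (τG≈Rel (λ _ _ → refl) λ _ _ → refl)) (steps eq)

    ⊨SliceIsσ⇔ : ∀ {xs c c₀} → (∀ i → xs i < B) → TermBelow (fresh 5) c → eval τ c ≡ just c₀ →
                 τ ⊨ SliceIs xs c ⇔ FunEq V (slice V c₀ H) (valVec V σ xs)
    ⊨SliceIsσ⇔ {xs} xs<B c<fresh5 eval-c =
      ⊨SliceIs⇔ (valVec V σ xs) xs<B c<fresh5 eval-c (λ i v → sym (agree σ≈τ _ _ (xs<B i) v)) τ-h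

  ⊨φ*⇔Chain : ∀ σ → σ ⊨ φ* ⇔ Chain V (Rel V σ fs gs φ) (valVec V σ fs) (valVec V σ gs)
  ⊨φ*⇔Chain σ = mk⇔ to from
    where
      to : σ ⊨ φ* → Chain V (Rel V σ fs gs φ) (valVec V σ fs) (valVec V σ gs)
      to (S , α , β , ⊨∃H) with ⊨∃ⁿ⁻ (λ i → suc (r i)) hName Body ⊨∃H
      ... | H , da , db , ⊨sliceA , ⊨sliceB , ⊨reach , ⊨step = record
        { next    = S
        ; start   = a₀
        ; end     = b₀
        ; table   = H
        ; starts  = Equivalence.to (⊨SliceIsσ⇔ fs<B aT<fresh5 eval-a) ⊨sliceA
        ; ends    = Equivalence.to (⊨SliceIsσ⇔ gs<B bT<fresh5 eval-b) ⊨sliceB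
        ; reaches = Equivalence.to (⊨Reach⇔ eval-a eval-b) ⊨reach
        ; steps   = Equivalence.to ⊨Step⇔ ⊨step
        }
        where
          open Witnessed σ S α β H
          a₀ = proj₁ (defined⇒just da)
          b₀ = proj₁ (defined⇒just db)
          eval-a : eval τ aT ≡ just a₀
          eval-a = proj₂ (defined⇒just da)
          eval-b : eval τ bT ≡ just b₀
          eval-b = proj₂ (defined⇒just db)

      from : Chain V (Rel V σ fs gs φ) (valVec V σ fs) (valVec V σ gs) → σ ⊨ φ*
      from chain = next , constant start , constant end ,
        ⊨∃ⁿ⁺ (λ i → suc (r i)) hName Body table
          ( just-defined eval-a , just-defined eval-b
          , Equivalence.from (⊨SliceIsσ⇔ fs<B aT<fresh5 eval-a) starts
          , Equivalence.from (⊨SliceIsσ⇔ gs<B bT<fresh5 eval-b) ends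
          , Equivalence.from (⊨Reach⇔ eval-a eval-b) reaches
          , Equivalence.from ⊨Step⇔ steps )
        where
          open Chain chain
          open Witnessed σ next (constant start) (constant end) table
          eval-a : eval τ aT ≡ just start
          eval-a = value-cong τ-a
          eval-b : eval τ bT ≡ just end
          eval-b = value-cong τ-b

  Rel-respects : ∀ σ → RespectsFunEq V (Rel V σ fs gs φ)
  Rel-respects σ F≈F′ G≈G′ =
    ⊨-agree φ φ<B (updateVec-agree V gs (updateVec-agree V fs (agreeing λ _ _ _ _ → refl) F≈F′) G≈G′)

theorem4 : ∀ {n} (V : Vocabulary n) (fs gs : VarVec V) → Distinct V fs gs →
    (φ : Formula) →
    Σ Formula λ φ* → ∀ (σ : Structure) →
      (σ ⊨ φ*) ⇔ Star V (Rel V σ fs gs φ) (valVec V σ fs) (valVec V σ gs)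
theorem4 V fs gs distinct φ = φ* , λ σ → ⇔.trans (⊨φ*⇔Chain σ) (Chain⇔Star (Rel-respects σ))
  where open StarFormula V fs gs distinct φ
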